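{- Let $x, y \in \mathbb{Z}$ and let $p \geq 3$ be a prime such that $x^2 - 2 = y^p$ and $y \neq -1$. Then: (1) Every prime factor of $\frac{y^p-1}{y-1}$ is congruent to $\pm 1 \pmod{12}$. (2) Every prime factor of $\frac{y^p-1}{y-1}$ is either $p$ or congruent to $1 \pmod{p}$. Either $p \nmid (y-1)$ and $\frac{y^p-1}{y-1} \equiv 1 \pmod{p}$, or $p \mid (y-1)$ and $\frac{y^p-1}{y-1} \equiv p \pmod{p^2}$; the latter case cannot happen unless $p \equiv \pm 1 \pmod{12}$. (3) $\frac{y^p-1}{y-1} \equiv 1 \pmod{24}$. (4) If $p \equiv 2 \pmod{3}$ or $p = 3$, then $3 \nmid x$. -}

module Defs where

open import Data.Nat using (ℕ; zero; suc)
open import Data.Integer using (ℤ; +_; -[1+_]; _+_; _-_; _*_; _^_)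
open import Data.Integer.Divisibility using (_∣_)
open import Data.Nat.Primality using (Prime)
open import Data.Product using (_×_)
open import Data.Sum using (_⊎_)
open import Relation.Nullary using (¬_)

-- cyclo y p = 1 + y + y^2 + ... + y^(p-1) = (y^p - 1)/(y - 1)  (for y ≠ 1)
cyclo : ℤ → ℕ → ℤ
cyclo y zero    = + 0
cyclo y (suc n) = cyclo y n + y ^ n

infix 4 _≡ₘ_[mod_]
_≡ₘ_[mod_] : ℤ → ℤ → ℤ → Set
a ≡ₘ b [mod m ] = m ∣ (a - b)

≡±1[mod_] : ℤ → ℤ → Set
≡±1[mod m ] a = (a ≡ₘ + 1 [mod m ]) ⊎ (a ≡ₘ -[1+ 0 ] [mod m ])

module Submission where

-- Since (y - 1) Φ = y ^ p - 1 = x ^ 2 - 3 for Φ = cyclo y p, the number 3 is a square modulo every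
-- prime factor q of Φ.  Modulo 8 the equation forces y ≡ -1, hence Φ ≡ 1, so q ≠ 2; modulo 9 it
-- excludes q = 3.  For the other q, the element τ = ζ + ζ⁻¹ of ℤ[ζ₁₂] has τ ^ 2 = 3, so by Fermat
-- τ ^ q = 3 ^ ((q - 1) / 2) τ ≡ τ (mod q), while by Frobenius τ ^ q ≡ ζ ^ q + ζ ^ -q, which is -τ
-- when q ≡ ±5 (mod 12).  Hence q ≡ ±1 (mod 12), and so is Φ, which with Φ ≡ 1 (mod 8) gives
-- Φ ≡ 1 (mod 24).  If q ∤ y - 1, the order of y modulo q is p and divides q - 1; otherwise
-- Φ ≡ p (mod q) and q = p.  Fermat, and the expansion of (1 + a) ^ i modulo a ^ 2, give Φ modulo
-- p and p ^ 2.  Finally, 3 ∣ x forces y ≡ 1 (mod 3), and then p ≡ Φ ≡ 1 (mod 3).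

open import Algebra.Bundles using (AbelianGroup; CommutativeRing; CommutativeSemiring; Semiring)
import Algebra.Consequences.Setoid as Consequences
import Algebra.Construct.DirectProduct as DirectProduct
open import Algebra.Core using (Op₂)
open import Algebra.Structures using (IsCommutativeRing)
open import Data.Fin.Base as Fin using (Fin; toℕ; fromℕ; inject₁)
open import Data.Fin.Properties using (toℕ-fromℕ; toℕ-inject₁; toℕ<n)
open import Data.Nat.Base as ℕ using (ℕ; zero; suc; _∸_; NonZero; z≤n; s≤s)
open import Data.Nat.Combinatorics using (_C_; nCn≡1; nC1≡n; nCk+nC[k+1]≡[n+1]C[k+1])
open import Data.Nat.Coprimality using (Coprime; coprime-Bézout)
import Data.Nat.Divisibility as ℕ∣
import Data.Nat.DivMod as ℕ
open import Data.Nat.GCD using (module Bézout)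
open import Data.Nat.Primality
  using (Prime; euclidsLemma; prime⇒irreducible; ¬prime[0]; ¬prime[1]; prime[2]; prime?)
open import Data.Nat.Primality.Factorisation using (PrimeFactorisation; factorise)
import Data.Nat.Properties as ℕ
open import Data.Product using (∃-syntax; _,_; proj₁; proj₂)
open import Data.Sum as Sum using (_⊎_; inj₁; inj₂; [_,_]′)
open import Function using (_∘_; id; flip)
open import Level using (0ℓ; _⊔_)
open import Relation.Binary.Bundles using (Setoid)
open import Relation.Binary.PropositionalEquality as ≡ using (_≡_; _≢_; refl; module ≡-Reasoning)
open import Relation.Nullary using (¬_; Dec; yes; no; contradiction)
open import Relation.Nullary.Decidable using (from-yes; from-no; map′; _⊎-dec_; _→-dec_)

[k+1]*[n+1]C[k+1]≡[n+1]*nCk : ∀ n k → suc k ℕ.* (suc n C suc k) ≡ suc n ℕ.* (n C k)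
[k+1]*[n+1]C[k+1]≡[n+1]*nCk zero    zero    = refl
[k+1]*[n+1]C[k+1]≡[n+1]*nCk zero    (suc k) = ℕ.*-zeroʳ (suc (suc k))
[k+1]*[n+1]C[k+1]≡[n+1]*nCk (suc n) zero    = begin
  suc (suc n) C 1 ℕ.+ 0 ≡⟨ ℕ.+-identityʳ _ ⟩
  suc (suc n) C 1       ≡⟨ nC1≡n (suc (suc n)) ⟩
  suc (suc n)           ≡⟨ ℕ.*-identityʳ (suc (suc n)) ⟨
  suc (suc n) ℕ.* 1     ∎
  where open ≡-Reasoning
[k+1]*[n+1]C[k+1]≡[n+1]*nCk (suc n) (suc k) = begin
  suc (suc k) ℕ.* (suc (suc n) C suc (suc k))
    ≡⟨ ≡.cong (suc (suc k) ℕ.*_) (nCk+nC[k+1]≡[n+1]C[k+1] (suc n) (suc k)) ⟨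
  suc (suc k) ℕ.* (suc n C suc k ℕ.+ suc n C suc (suc k))
    ≡⟨ ℕ.*-distribˡ-+ (suc (suc k)) (suc n C suc k) _ ⟩
  (suc n C suc k ℕ.+ suc k ℕ.* (suc n C suc k)) ℕ.+ suc (suc k) ℕ.* (suc n C suc (suc k))
    ≡⟨ ≡.cong₂ (λ a b → (suc n C suc k ℕ.+ a) ℕ.+ b) ([k+1]*[n+1]C[k+1]≡[n+1]*nCk n k)
                                                     ([k+1]*[n+1]C[k+1]≡[n+1]*nCk n (suc k)) ⟩
  (suc n C suc k ℕ.+ suc n ℕ.* (n C k)) ℕ.+ suc n ℕ.* (n C suc k)
    ≡⟨ ℕ.+-assoc (suc n C suc k) _ _ ⟩
  suc n C suc k ℕ.+ (suc n ℕ.* (n C k) ℕ.+ suc n ℕ.* (n C suc k))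
    ≡⟨ ≡.cong (suc n C suc k ℕ.+_) (ℕ.*-distribˡ-+ (suc n) (n C k) (n C suc k)) ⟨
  suc n C suc k ℕ.+ suc n ℕ.* (n C k ℕ.+ n C suc k)
    ≡⟨ ≡.cong (λ m → suc n C suc k ℕ.+ suc n ℕ.* m) (nCk+nC[k+1]≡[n+1]C[k+1] n k) ⟩
  suc (suc n) ℕ.* (suc n C suc k)
    ∎
  where open ≡-Reasoning

p∣pCk : ∀ {p k} → Prime p → 0 ℕ.< k → k ℕ.< p → p ℕ∣.∣ p C k
p∣pCk {zero}  p-prime _ _ = contradiction p-prime ¬prime[0]
p∣pCk {suc n} {suc j} p-prime _ k<p
  with euclidsLemma (suc j) (suc n C suc j) p-prime
         (≡.subst (suc n ℕ∣.∣_) (≡.sym ([k+1]*[n+1]C[k+1]≡[n+1]*nCk n j)) (ℕ∣.m∣m*n (n C j)))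
... | inj₁ p∣k    = contradiction (ℕ∣.∣⇒≤ p∣k) (ℕ.<⇒≱ k<p)
... | inj₂ p∣pCk = p∣pCk

module Frobenius {c ℓ} (S : CommutativeSemiring c ℓ) where

  open CommutativeSemiring S renaming (refl to ≈-refl; sym to ≈-sym; trans to ≈-trans)
  open import Algebra.Definitions.RawMonoid +-rawMonoid using (sum)
  open import Algebra.Properties.CommutativeMonoid.Mult +-commutativeMonoid using (×-distrib-+)
  open import Algebra.Properties.CommutativeSemiring.Binomial S using (theorem; binomialTerm)
  open import Algebra.Properties.Monoid.Mult +-monoid using (×-assocˡ; ×-congˡ)
  open import Algebra.Properties.Monoid.Sum +-monoid using (sum-init-last)
  open import Algebra.Properties.Semiring.Exp semiring using (_^_)
  open import Algebra.Properties.Semiring.Mult semiring using (_×_)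
  open import Relation.Binary.Reasoning.Setoid setoid

  Multiple : ℕ → Carrier → Set (c ⊔ ℓ)
  Multiple n x = ∃[ z ] x ≈ n × z

  ×-zeroʳ : ∀ n → n × 0# ≈ 0#
  ×-zeroʳ zero    = ≈-refl
  ×-zeroʳ (suc n) = ≈-trans (+-identityˡ (n × 0#)) (×-zeroʳ n)

  multiple-+ : ∀ {n x y} → Multiple n x → Multiple n y → Multiple n (x + y)
  multiple-+ {n} (z , x≈nz) (w , y≈nw) = z + w , ≈-trans (+-cong x≈nz y≈nw) (≈-sym (×-distrib-+ z w n))

  multiple-sum : ∀ {n m} (t : Fin m → Carrier) → (∀ i → Multiple n (t i)) → Multiple n (sum t)
  multiple-sum {n} {zero}  t _        = 0# , ≈-sym (×-zeroʳ n)
  multiple-sum {n} {suc m} t multiple =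
    multiple-+ {n} (multiple Fin.zero) (multiple-sum {n} (t ∘ Fin.suc) (multiple ∘ Fin.suc))

  multiple-× : ∀ {n m} → n ℕ∣.∣ m → ∀ x → Multiple n (m × x)
  multiple-× {n} (ℕ∣.divides k refl) x = k × x , ≈-trans (×-congˡ (ℕ.*-comm k n)) (≈-sym (×-assocˡ x n k))

  frobenius : ∀ {p} → Prime p → ∀ x y → ∃[ z ] (x + y) ^ p ≈ x ^ p + y ^ p + p × z
  frobenius {zero}  p-prime _ _ = contradiction p-prime ¬prime[0]
  frobenius {suc n} p-prime x y = z , (begin
    (x + y) ^ p                                 ≈⟨ theorem p x y ⟩
    term Fin.zero + sum (term ∘ Fin.suc)        ≈⟨ +-cong first (sum-init-last (term ∘ Fin.suc)) ⟩
    y ^ p + (middle + term (Fin.suc (fromℕ n))) ≈⟨ +-congˡ (+-congˡ (last (≡.cong suc (toℕ-fromℕ n)))) ⟩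
    y ^ p + (middle + x ^ p)                    ≈⟨ +-congˡ (+-comm middle (x ^ p)) ⟩
    y ^ p + (x ^ p + middle)                    ≈⟨ +-assoc (y ^ p) (x ^ p) middle ⟨
    y ^ p + x ^ p + middle                      ≈⟨ +-congʳ (+-comm (y ^ p) (x ^ p)) ⟩
    x ^ p + y ^ p + middle                      ≈⟨ +-congˡ middle≈pz ⟩
    x ^ p + y ^ p + p × z                       ∎)
    where
    p : ℕ
    p = suc n

    term : Fin (suc p) → Carrier
    term = binomialTerm x y p

    middle : Carrier
    middle = sum (term ∘ Fin.suc ∘ inject₁)

    first : term Fin.zero ≈ y ^ p
    first = ≈-trans (+-identityʳ _) (*-identityˡ _)

    last : ∀ {k} → k ≡ p → (p C k) × (x ^ k * y ^ (p ∸ k)) ≈ x ^ p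
    last refl rewrite nCn≡1 p | ℕ.n∸n≡0 p = ≈-trans (+-identityʳ _) (*-identityʳ _)

    middle-multiple : ∀ i → Multiple p (term (Fin.suc (inject₁ i)))
    middle-multiple i = multiple-× (p∣pCk p-prime (s≤s z≤n) (s≤s i<n)) _
      where
      i<n : toℕ (inject₁ i) ℕ.< n
      i<n = ≡.subst (ℕ._< n) (≡.sym (toℕ-inject₁ i)) (toℕ<n i)

    middle-is-multiple : Multiple p middle
    middle-is-multiple = multiple-sum {p} (term ∘ Fin.suc ∘ inject₁) middle-multiple

    z : Carrier
    z = proj₁ middle-is-multiple

    middle≈pz : middle ≈ p × z
    middle≈pz = proj₂ middle-is-multiple

module _ {c ℓ} (S : Semiring c ℓ) where

  open Semiring S renaming (refl to ≈-refl; trans to ≈-trans)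
  open import Algebra.Properties.Semiring.Exp S using (_^_; ^-homo-*; ^-assocʳ; ^-congˡ; ^-congʳ)
  open import Relation.Binary.Reasoning.Setoid setoid

  1#^n≈1# : ∀ n → 1# ^ n ≈ 1#
  1#^n≈1# zero    = ≈-refl
  1#^n≈1# (suc n) = ≈-trans (*-identityˡ (1# ^ n)) (1#^n≈1# n)

  ^-periodic : ∀ {x n} → x ^ n ≈ 1# → ∀ r j → x ^ (r ℕ.+ j ℕ.* n) ≈ x ^ r
  ^-periodic {x} {n} xⁿ≈1 r j = begin
    x ^ (r ℕ.+ j ℕ.* n)     ≈⟨ ^-homo-* x r (j ℕ.* n) ⟩
    x ^ r * x ^ (j ℕ.* n)   ≈⟨ *-congˡ (^-congʳ x (ℕ.*-comm j n)) ⟩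
    x ^ r * x ^ (n ℕ.* j)   ≈⟨ *-congˡ (^-assocʳ x n j) ⟨
    x ^ r * (x ^ n) ^ j     ≈⟨ *-congˡ (^-congˡ j xⁿ≈1) ⟩
    x ^ r * 1# ^ j          ≈⟨ *-congˡ (1#^n≈1# j) ⟩
    x ^ r * 1#              ≈⟨ *-identityʳ (x ^ r) ⟩
    x ^ r                   ∎

-- Quadratic extensions

open import Data.Product using (_×_)

-- The ring R[θ] with θ ^ 2 = s θ + t; the pair (a , b) stands for a + b θ.
module QuadraticExtension {c ℓ} (R : CommutativeRing c ℓ) (s t : CommutativeRing.Carrier R) where

  open CommutativeRing R hiding (isCommutativeRing) renaming (refl to ≈-refl; trans to ≈-trans)
  open import Algebra.Solver.Ring.NaturalCoefficients.Default commutativeSemiring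
    using (solve; _:=_; _:+_; _:*_)
  open import Algebra.Properties.Semiring.Exp semiring using (_^_)
  import Algebra.Properties.Semiring.Mult semiring as Mult

  +ᵉ-abelianGroup : AbelianGroup c ℓ
  +ᵉ-abelianGroup = DirectProduct.abelianGroup +-abelianGroup +-abelianGroup

  open AbelianGroup +ᵉ-abelianGroup public using ()
    renaming ( _≈_ to infix 4 _≈ᵉ_; _∙_ to infixl 6 _+ᵉ_; ε to 0ᵉ; _⁻¹ to -ᵉ_; setoid to ᵉ-setoid
             ; ∙-cong to +ᵉ-cong; isAbelianGroup to +ᵉ-isAbelianGroup)

  infixl 7 _*ᵉ_
  _*ᵉ_ : Op₂ (Carrier × Carrier)
  (a , b) *ᵉ (c , d) = a * c + t * (b * d) , (a * d + b * c) + s * (b * d)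

  1ᵉ : Carrier × Carrier
  1ᵉ = 1# , 0#

  *ᵉ-cong : ∀ {x x′ y y′} → x ≈ᵉ x′ → y ≈ᵉ y′ → x *ᵉ y ≈ᵉ x′ *ᵉ y′
  *ᵉ-cong (a≈ , b≈) (c≈ , d≈) =
      +-cong (*-cong a≈ c≈) (*-congˡ (*-cong b≈ d≈))
    , +-cong (+-cong (*-cong a≈ d≈) (*-cong b≈ c≈)) (*-congˡ (*-cong b≈ d≈))

  *ᵉ-assoc : ∀ x y z → (x *ᵉ y) *ᵉ z ≈ᵉ x *ᵉ (y *ᵉ z)
  *ᵉ-assoc (a , b) (c , d) (e , f) =
      solve 8 (λ s t a b c d e f →
          (a :* c :+ t :* (b :* d)) :* e :+ t :* ((a :* d :+ b :* c :+ s :* (b :* d)) :* f)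
        := a :* (c :* e :+ t :* (d :* f)) :+ t :* (b :* (c :* f :+ d :* e :+ s :* (d :* f))))
        ≈-refl s t a b c d e f
    , solve 8 (λ s t a b c d e f →
          (a :* c :+ t :* (b :* d)) :* f :+ (a :* d :+ b :* c :+ s :* (b :* d)) :* e
            :+ s :* ((a :* d :+ b :* c :+ s :* (b :* d)) :* f)
        := a :* (c :* f :+ d :* e :+ s :* (d :* f)) :+ b :* (c :* e :+ t :* (d :* f))
            :+ s :* (b :* (c :* f :+ d :* e :+ s :* (d :* f))))
        ≈-refl s t a b c d e f

  *ᵉ-comm : ∀ x y → x *ᵉ y ≈ᵉ y *ᵉ x
  *ᵉ-comm (a , b) (c , d) =
      solve 6 (λ s t a b c d → a :* c :+ t :* (b :* d) := c :* a :+ t :* (d :* b)) ≈-refl s t a b c d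
    , solve 6 (λ s t a b c d → a :* d :+ b :* c :+ s :* (b :* d) := c :* b :+ d :* a :+ s :* (d :* b))
        ≈-refl s t a b c d

  *ᵉ-distribˡ : ∀ x y z → x *ᵉ (y +ᵉ z) ≈ᵉ x *ᵉ y +ᵉ x *ᵉ z
  *ᵉ-distribˡ (a , b) (c , d) (e , f) =
      solve 8 (λ s t a b c d e f →
          a :* (c :+ e) :+ t :* (b :* (d :+ f)) := (a :* c :+ t :* (b :* d)) :+ (a :* e :+ t :* (b :* f)))
        ≈-refl s t a b c d e f
    , solve 8 (λ s t a b c d e f →
          a :* (d :+ f) :+ b :* (c :+ e) :+ s :* (b :* (d :+ f))
        := (a :* d :+ b :* c :+ s :* (b :* d)) :+ (a :* f :+ b :* e :+ s :* (b :* f)))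
        ≈-refl s t a b c d e f

  *ᵉ-identityˡ : ∀ x → 1ᵉ *ᵉ x ≈ᵉ x
  *ᵉ-identityˡ (a , b) =
      ≈-trans (+-cong (*-identityˡ a) (annihilate t b)) (+-identityʳ a)
    , ≈-trans (+-cong (+-cong (*-identityˡ b) (zeroˡ a)) (annihilate s b))
              (≈-trans (+-identityʳ _) (+-identityʳ b))
    where
    annihilate : ∀ u v → u * (0# * v) ≈ 0#
    annihilate u v = ≈-trans (*-congˡ (zeroˡ v)) (zeroʳ u)

  isCommutativeRing : IsCommutativeRing _≈ᵉ_ _+ᵉ_ _*ᵉ_ -ᵉ_ 0ᵉ 1ᵉ
  isCommutativeRing = record
    { isRing = record
      { +-isAbelianGroup = +ᵉ-isAbelianGroup
      ; *-cong           = *ᵉ-cong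
      ; *-assoc          = *ᵉ-assoc
      ; *-identity       = comm∧idˡ⇒id *ᵉ-comm *ᵉ-identityˡ
      ; distrib          = comm∧distrˡ⇒distr +ᵉ-cong *ᵉ-comm *ᵉ-distribˡ
      }
    ; *-comm = *ᵉ-comm
    }
    where open Consequences ᵉ-setoid

  commutativeRing : CommutativeRing c ℓ
  commutativeRing = record { isCommutativeRing = isCommutativeRing }

  open CommutativeRing commutativeRing public using ()
    renaming ( semiring to semiringᵉ; refl to ≈ᵉ-refl; reflexive to ≈ᵉ-reflexive; trans to ≈ᵉ-trans
             ; *-congˡ to *ᵉ-congˡ)
  open import Algebra.Properties.Semiring.Exp semiringᵉ public using () renaming (_^_ to infixr 8 _^ᵉ_)
  open import Algebra.Properties.Semiring.Mult semiringᵉ public using () renaming (_×_ to infixr 8 _×ᵉ_)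

  embed : Carrier → Carrier × Carrier
  embed a = a , 0#

  embed-cong : ∀ {a b} → a ≈ b → embed a ≈ᵉ embed b
  embed-cong a≈b = a≈b , ≈-refl

  *ᵉ-embedʳ : ∀ x c → x *ᵉ embed c ≈ᵉ (proj₁ x * c , proj₂ x * c)
  *ᵉ-embedʳ (a , b) c =
      ≈-trans (+-congˡ (annihilate t b)) (+-identityʳ (a * c))
    , ≈-trans (+-cong (+-congʳ (zeroʳ a)) (annihilate s b)) (≈-trans (+-identityʳ _) (+-identityˡ (b * c)))
    where
    annihilate : ∀ u v → u * (v * 0#) ≈ 0#
    annihilate u v = ≈-trans (*-congˡ (zeroʳ v)) (zeroʳ u)

  embed-^ : ∀ a n → embed a ^ᵉ n ≈ᵉ embed (a ^ n)
  embed-^ a zero    = ≈ᵉ-refl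
  embed-^ a (suc n) =
    ≈ᵉ-trans (*ᵉ-congˡ (embed-^ a n)) (≈ᵉ-trans (*ᵉ-embedʳ (embed a) (a ^ n)) (≈-refl , zeroˡ (a ^ n)))

  ×ᵉ-pointwise : ∀ n x → n ×ᵉ x ≈ᵉ (n Mult.× proj₁ x , n Mult.× proj₂ x)
  ×ᵉ-pointwise zero    x = ≈ᵉ-refl
  ×ᵉ-pointwise (suc n) x = +-congˡ (proj₁ (×ᵉ-pointwise n x)) , +-congˡ (proj₂ (×ᵉ-pointwise n x))

open import Defs
open import Data.Integer.Base using (ℤ; +_; -[1+_]; _+_; _-_; _*_; -_; _^_; 0ℤ; 1ℤ; -1ℤ)
import Data.Integer.Base as ℤ using (∣_∣)
import Data.Integer.DivMod as ℤ
import Data.Integer.Properties as ℤ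
open import Data.Integer.Tactic.RingSolver using (solve-∀)
open import Data.List.Base using ([]; _∷_)
open import Data.List.Relation.Unary.All using (All; []; _∷_)
open import Data.Nat.ListAction using (product)
open import Algebra.Properties.Semiring.Exp ℤ.+-*-semiring using () renaming (_^_ to _^ᴿ_)
open import Algebra.Properties.Semiring.Mult ℤ.+-*-semiring using () renaming (_×_ to _×ᴿ_)

-- The semiring power and multiple of ℤ, in which the generic lemmas are stated, agree with ℤ's _^_
-- and _*_ only propositionally.
^ᴿ≡^ : ∀ x n → x ^ᴿ n ≡ x ^ n
^ᴿ≡^ x zero    = refl
^ᴿ≡^ x (suc n) = ≡.cong (x *_) (^ᴿ≡^ x n)

×ᴿ≡* : ∀ n x → n ×ᴿ x ≡ x * + n
×ᴿ≡* zero    x = ≡.sym (ℤ.*-zeroʳ x)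
×ᴿ≡* (suc n) x = ≡.trans (≡.cong (_+_ x) (×ᴿ≡* n x)) (≡.sym (ℤ.*-suc x (+ n)))

-- Signed divisibility is opened only inside this module: the statement of the theorem uses the
-- unsigned _∣_ of Data.Integer.Divisibility.
module _ where

  open import Data.Integer.Divisibility.Signed
  open ≡ using (sym; trans; cong; cong₂; subst)

  -- Defs' _≡ₘ_[mod_], as a record over signed divisibility so that a and b can be inferred.
  infix 4 _≡_[mod_]
  record _≡_[mod_] (a b m : ℤ) : Set where
    constructor mk
    field m∣a-b : m ∣ a - b
  open _≡_[mod_] public

  module _ {m : ℤ} where

    ≡⇒≡-mod : ∀ {a b} → a ≡ b → a ≡ b [mod m ]
    ≡⇒≡-mod {a} refl = mk (divides 0ℤ (trans (ℤ.+-inverseʳ a) (sym (ℤ.*-zeroˡ m))))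

    ≡-mod-refl : ∀ {a} → a ≡ a [mod m ]
    ≡-mod-refl = ≡⇒≡-mod refl

    ≡-mod-sym : ∀ {a b} → a ≡ b [mod m ] → b ≡ a [mod m ]
    ≡-mod-sym {a} {b} (mk m∣a-b) = mk (subst (m ∣_) (lemma a b) (∣m⇒∣-m m∣a-b))
      where lemma : ∀ a b → - (a - b) ≡ b - a
            lemma = solve-∀

    ≡-mod-trans : ∀ {a b c} → a ≡ b [mod m ] → b ≡ c [mod m ] → a ≡ c [mod m ]
    ≡-mod-trans {a} {b} {c} (mk m∣a-b) (mk m∣b-c) = mk (subst (m ∣_) (lemma a b c) (∣m∣n⇒∣m+n m∣a-b m∣b-c))
      where lemma : ∀ a b c → (a - b) + (b - c) ≡ a - c
            lemma = solve-∀

    +-cong-mod : ∀ {a b c d} → a ≡ b [mod m ] → c ≡ d [mod m ] → a + c ≡ b + d [mod m ]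
    +-cong-mod {a} {b} {c} {d} (mk m∣a-b) (mk m∣c-d) =
      mk (subst (m ∣_) (lemma a b c d) (∣m∣n⇒∣m+n m∣a-b m∣c-d))
      where lemma : ∀ a b c d → (a - b) + (c - d) ≡ (a + c) - (b + d)
            lemma = solve-∀

    -‿cong-mod : ∀ {a b} → a ≡ b [mod m ] → - a ≡ - b [mod m ]
    -‿cong-mod {a} {b} (mk m∣a-b) = mk (subst (m ∣_) (lemma a b) (∣m⇒∣-m m∣a-b))
      where lemma : ∀ a b → - (a - b) ≡ - a - - b
            lemma = solve-∀

    *-cong-mod : ∀ {a b c d} → a ≡ b [mod m ] → c ≡ d [mod m ] → a * c ≡ b * d [mod m ]
    *-cong-mod {a} {b} {c} {d} (mk m∣a-b) (mk m∣c-d) =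
      mk (subst (m ∣_) (lemma a b c d) (∣m∣n⇒∣m+n (∣m⇒∣m*n c m∣a-b) (∣n⇒∣m*n b m∣c-d)))
      where lemma : ∀ a b c d → (a - b) * c + b * (c - d) ≡ a * c - b * d
            lemma = solve-∀

    ^-cong-mod : ∀ {a b} n → a ≡ b [mod m ] → a ^ n ≡ b ^ n [mod m ]
    ^-cong-mod zero    _   = ≡-mod-refl
    ^-cong-mod (suc n) a≡b = *-cong-mod a≡b (^-cong-mod n a≡b)

    ∣⇒≡0-mod : ∀ {a} → m ∣ a → a ≡ 0ℤ [mod m ]
    ∣⇒≡0-mod {a} = mk ∘ subst (m ∣_) (sym (ℤ.+-identityʳ a))

    ≡0-mod⇒∣ : ∀ {a} → a ≡ 0ℤ [mod m ] → m ∣ a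
    ≡0-mod⇒∣ {a} = subst (m ∣_) (ℤ.+-identityʳ a) ∘ m∣a-b

    ∣-resp-≡-mod : ∀ {a b} → a ≡ b [mod m ] → m ∣ a → m ∣ b
    ∣-resp-≡-mod a≡b m∣a = ≡0-mod⇒∣ (≡-mod-trans (≡-mod-sym a≡b) (∣⇒≡0-mod m∣a))

    ≡-mod-∣ : ∀ {d a b} → d ∣ m → a ≡ b [mod m ] → a ≡ b [mod d ]
    ≡-mod-∣ d∣m (mk m∣a-b) = mk (∣-trans d∣m m∣a-b)

    +-multiple-≡-mod : ∀ a k → a + k * m ≡ a [mod m ]
    +-multiple-≡-mod a k = mk (divides k (lemma a (k * m)))
      where lemma : ∀ a b → (a + b) - a ≡ b
            lemma = solve-∀

  ≡-mod-setoid : ℤ → Setoid 0ℓ 0ℓ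
  ≡-mod-setoid m = record
    { Carrier       = ℤ
    ; _≈_           = _≡_[mod m ]
    ; isEquivalence = record { refl = ≡-mod-refl ; sym = ≡-mod-sym ; trans = ≡-mod-trans }
    }

  module ≡-mod-Reasoning (m : ℤ) where
    open import Relation.Binary.Reasoning.Setoid (≡-mod-setoid m) public

  infix 4 _≡?_[mod_]
  _≡?_[mod_] : ∀ a b m → Dec (a ≡ b [mod m ])
  a ≡? b [mod m ] = map′ mk m∣a-b (m ∣? a - b)

  residue : ∀ m .{{_ : NonZero m}} a → ∃[ r ] r ℕ.< m × a ≡ + r [mod + m ]
  residue m a = r , ℤ.n%d<d a (+ m) ,
    mk (divides (a ℤ./ + m) (trans (cong (_- + r) (ℤ.a≡a%n+[a/n]*n a (+ m)))
                                   (lemma (+ r) ((a ℤ./ + m) * + m))))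
    where
    r : ℕ
    r = a ℤ.% + m
    lemma : ∀ r s → (r + s) - r ≡ s
    lemma = solve-∀

  *-pres-∣ : ∀ {a b c d} → a ∣ b → c ∣ d → a * c ∣ b * d
  *-pres-∣ {a} {c = c} (divides s refl) (divides t refl) = divides (s * t) (lemma s a t c)
    where lemma : ∀ s a t c → s * a * (t * c) ≡ s * t * (a * c)
          lemma = solve-∀

  prime[3] : Prime 3
  prime[3] = from-yes (prime? 3)

  prime∣prime⇒≡ : ∀ {p q} → Prime p → Prime q → p ℕ∣.∣ q → p ≡ q
  prime∣prime⇒≡ p-prime q-prime p∣q with prime⇒irreducible q-prime p∣q
  ... | inj₁ refl = contradiction p-prime ¬prime[1]
  ... | inj₂ p≡q  = p≡q

  prime∤⇒coprime : ∀ {p n} → Prime p → ¬ (p ℕ∣.∣ n) → Coprime p n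
  prime∤⇒coprime p-prime p∤n (d∣p , d∣n) with prime⇒irreducible p-prime d∣p
  ... | inj₁ d≡1  = d≡1
  ... | inj₂ refl = contradiction d∣n p∤n

  prime∤1 : ∀ {q} → Prime q → ¬ (+ q ∣ 1ℤ)
  prime∤1 q-prime q∣1 with ℕ∣.∣1⇒≡1 (∣⇒∣ᵤ q∣1)
  ... | refl = ¬prime[1] q-prime

  odd-prime : ∀ {q} → Prime q → q ≢ 2 → ∃[ h ] q ≡ suc (2 ℕ.* h)
  odd-prime {q} q-prime q≢2 = from-remainder (q ℕ.% 2) (ℕ.m%n<n q 2) (ℕ.m≡m%n+[m/n]*n q 2)
    where
    from-remainder : ∀ r → r ℕ.< 2 → q ≡ r ℕ.+ q ℕ./ 2 ℕ.* 2 → ∃[ h ] q ≡ suc (2 ℕ.* h)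
    from-remainder 0 _ q≡2k =
      contradiction (sym (prime∣prime⇒≡ prime[2] q-prime (ℕ∣.divides (q ℕ./ 2) q≡2k))) q≢2
    from-remainder 1 _ q≡1+2k = q ℕ./ 2 , trans q≡1+2k (cong suc (ℕ.*-comm (q ℕ./ 2) 2))
    from-remainder (suc (suc _)) (s≤s (s≤s ())) _

  euclidsLemmaℤ : ∀ {p} → Prime p → ∀ a b → + p ∣ a * b → (+ p ∣ a) ⊎ (+ p ∣ b)
  euclidsLemmaℤ p-prime a b p∣ab =
    Sum.map ∣ᵤ⇒∣ ∣ᵤ⇒∣ (euclidsLemma ℤ.∣ a ∣ ℤ.∣ b ∣ p-prime (subst (_ ℕ∣.∣_) (ℤ.abs-* a b) (∣⇒∣ᵤ p∣ab)))

  -- Fermat's little theorem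

  frobeniusℤ : ∀ {q} → Prime q → ∀ a b → (a + b) ^ q ≡ a ^ q + b ^ q [mod + q ]
  frobeniusℤ {q} q-prime a b = ≡-mod-trans (≡⇒≡-mod (begin
      (a + b) ^ q                 ≡⟨ ^ᴿ≡^ (a + b) q ⟨
      (a + b) ^ᴿ q                ≡⟨ proj₂ frobenius ⟩
      a ^ᴿ q + b ^ᴿ q + q ×ᴿ z    ≡⟨ cong₂ (λ u v → u + v + q ×ᴿ z) (^ᴿ≡^ a q) (^ᴿ≡^ b q) ⟩
      a ^ q + b ^ q + q ×ᴿ z      ≡⟨ cong (_+_ (a ^ q + b ^ q)) (×ᴿ≡* q z) ⟩
      a ^ q + b ^ q + z * + q     ∎))
    (+-multiple-≡-mod (a ^ q + b ^ q) z)
    where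
    open ≡-Reasoning
    frobenius : ∃[ z ] (a + b) ^ᴿ q ≡ a ^ᴿ q + b ^ᴿ q + q ×ᴿ z
    frobenius = Frobenius.frobenius ℤ.+-*-commutativeSemiring q-prime a b
    z : ℤ
    z = proj₁ frobenius

  fermat : ∀ {q} → Prime q → ∀ a → a ^ q ≡ a [mod + q ]
  fermat {zero}  q-prime _ = contradiction q-prime ¬prime[0]
  fermat {suc k} q-prime a = begin
    a ^ q      ≈⟨ ^-cong-mod q a≡r ⟩
    (+ r) ^ q  ≈⟨ fermat-ℕ r ⟩
    + r        ≈⟨ a≡r ⟨
    a          ∎
    where
    open ≡-mod-Reasoning (+ suc k)
    q r : ℕ
    q = suc k
    r = proj₁ (residue q a)
    a≡r : a ≡ + r [mod + q ]
    a≡r = proj₂ (proj₂ (residue q a))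

    fermat-ℕ : ∀ n → (+ n) ^ q ≡ + n [mod + q ]
    fermat-ℕ zero    = ≡-mod-refl
    fermat-ℕ (suc n) = begin
      (1ℤ + + n) ^ q       ≈⟨ frobeniusℤ q-prime 1ℤ (+ n) ⟩
      1ℤ ^ q + (+ n) ^ q   ≈⟨ +-cong-mod (≡⇒≡-mod (ℤ.^-zeroˡ q)) (fermat-ℕ n) ⟩
      1ℤ + + n             ∎

  fermat′ : ∀ {q} → Prime q → ∀ {a} → ¬ (+ q ∣ a) → a ^ (q ∸ 1) ≡ 1ℤ [mod + q ]
  fermat′ {zero}  q-prime _ = contradiction q-prime ¬prime[0]
  fermat′ {suc k} q-prime {a} q∤a =
    mk ([ flip contradiction q∤a , id ]′ (euclidsLemmaℤ q-prime a (a ^ k - 1ℤ) q∣a[aᵏ-1]))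
    where
    q∣a[aᵏ-1] : + suc k ∣ a * (a ^ k - 1ℤ)
    q∣a[aᵏ-1] = subst (+ suc k ∣_) (lemma a (a ^ k)) (m∣a-b (fermat q-prime a))
      where lemma : ∀ a b → a * b - a ≡ a * (b - 1ℤ)
            lemma = solve-∀

  x²≡a⇒aʰ≡1 : ∀ {q h x a} → Prime q → q ≡ suc (2 ℕ.* h) → ¬ (+ q ∣ a) →
              x ^ 2 ≡ a [mod + q ] → a ^ h ≡ 1ℤ [mod + q ]
  x²≡a⇒aʰ≡1 {q} {h} {x} {a} q-prime refl q∤a x²≡a = begin
    a ^ h           ≈⟨ ^-cong-mod h x²≡a ⟨
    (x ^ 2) ^ h     ≡⟨ ℤ.^-*-assoc x 2 h ⟩
    x ^ (2 ℕ.* h)   ≈⟨ fermat′ q-prime (q∤a ∘ ∣-resp-≡-mod x²≡a ∘ ∣m⇒∣m*n (x ^ 1)) ⟩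
    1ℤ              ∎
    where open ≡-mod-Reasoning (+ q)

  coprime-exponents⇒≡1 : ∀ {m a i j} → Coprime i j →
                         a ^ i ≡ 1ℤ [mod m ] → a ^ j ≡ 1ℤ [mod m ] → a ≡ 1ℤ [mod m ]
  coprime-exponents⇒≡1 {m} {a} {i} {j} i⊥j aⁱ≡1 aʲ≡1 = from-bézout (coprime-Bézout i⊥j)
    where
    open ≡-mod-Reasoning m

    power-of : ∀ {e} → a ^ e ≡ 1ℤ [mod m ] → ∀ u → a ^ (u ℕ.* e) ≡ 1ℤ [mod m ]
    power-of {e} aᵉ≡1 u = begin
      a ^ (u ℕ.* e)   ≡⟨ cong (a ^_) (ℕ.*-comm u e) ⟩
      a ^ (e ℕ.* u)   ≡⟨ ℤ.^-*-assoc a e u ⟨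
      (a ^ e) ^ u     ≈⟨ ^-cong-mod u aᵉ≡1 ⟩
      1ℤ ^ u          ≡⟨ ℤ.^-zeroˡ u ⟩
      1ℤ              ∎

    cancel : ∀ e f → suc e ≡ f → a ^ e ≡ 1ℤ [mod m ] → a ^ f ≡ 1ℤ [mod m ] → a ≡ 1ℤ [mod m ]
    cancel e f refl aᵉ≡1 aᶠ≡1 = begin
      a               ≡⟨ ℤ.*-identityʳ a ⟨
      a * 1ℤ          ≈⟨ *-cong-mod (≡-mod-refl {a = a}) aᵉ≡1 ⟨
      a * a ^ e       ≈⟨ aᶠ≡1 ⟩
      1ℤ              ∎

    from-bézout : Bézout.Identity 1 i j → a ≡ 1ℤ [mod m ]
    from-bézout (Bézout.+- u v 1+vj≡ui) =
      cancel (v ℕ.* j) (u ℕ.* i) 1+vj≡ui (power-of aʲ≡1 v) (power-of aⁱ≡1 u)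
    from-bézout (Bézout.-+ u v 1+ui≡vj) =
      cancel (u ℕ.* i) (v ℕ.* j) 1+ui≡vj (power-of aⁱ≡1 u) (power-of aʲ≡1 v)

  infix 4 _≡±1-mod_
  _≡±1-mod_ : ℤ → ℤ → Set
  a ≡±1-mod m = a ≡ 1ℤ [mod m ] ⊎ a ≡ -1ℤ [mod m ]

  ≡±1-* : ∀ {m a b} → a ≡±1-mod m → b ≡±1-mod m → a * b ≡±1-mod m
  ≡±1-* (inj₁ a≡1)  (inj₁ b≡1)  = inj₁ (*-cong-mod a≡1 b≡1)
  ≡±1-* (inj₁ a≡1)  (inj₂ b≡-1) = inj₂ (*-cong-mod a≡1 b≡-1)
  ≡±1-* (inj₂ a≡-1) (inj₁ b≡1)  = inj₂ (*-cong-mod a≡-1 b≡1)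
  ≡±1-* (inj₂ a≡-1) (inj₂ b≡-1) = inj₁ (*-cong-mod a≡-1 b≡-1)

  ≡±1-neg : ∀ {m a} → a ≡±1-mod m → - a ≡±1-mod m
  ≡±1-neg (inj₁ a≡1)  = inj₂ (-‿cong-mod a≡1)
  ≡±1-neg (inj₂ a≡-1) = inj₁ (-‿cong-mod a≡-1)

  module _ {m : ℤ} where

    product-≡±1 : ∀ qs → All Prime qs → (∀ {q} → Prime q → q ℕ∣.∣ product qs → + q ≡±1-mod m) →
                  + product qs ≡±1-mod m
    product-≡±1 []       []                   _        = inj₁ ≡-mod-refl
    product-≡±1 (q ∷ qs) (q-prime ∷ qs-prime) factors± =
      subst (_≡±1-mod m) (sym (ℤ.pos-* q (product qs)))
        (≡±1-* (factors± q-prime (ℕ∣.m∣m*n (product qs)))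
               (product-≡±1 qs qs-prime (λ r-prime r∣qs → factors± r-prime (ℕ∣.∣n⇒∣m*n q r∣qs))))

    +-prime-factors-≡±1⇒≡±1 : ∀ n .{{_ : NonZero n}} →
                              (∀ {q} → Prime q → q ℕ∣.∣ n → + q ≡±1-mod m) → + n ≡±1-mod m
    +-prime-factors-≡±1⇒≡±1 n factors± = subst (λ k → + k ≡±1-mod m) (sym isFactorisation)
      (product-≡±1 (PrimeFactorisation.factors (factorise n)) factorsPrime
        (λ q-prime q∣∏ → factors± q-prime (subst (_ ℕ∣.∣_) (sym isFactorisation) q∣∏)))
      where open PrimeFactorisation (factorise n) using (isFactorisation; factorsPrime)

    prime-factors-≡±1⇒≡±1 : ∀ c → c ≢ 0ℤ → (∀ {q} → Prime q → + q ∣ c → + q ≡±1-mod m) → c ≡±1-mod m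
    prime-factors-≡±1⇒≡±1 (+ zero)  c≢0 _        = contradiction refl c≢0
    prime-factors-≡±1⇒≡±1 (+ suc n) _   factors± =
      +-prime-factors-≡±1⇒≡±1 (suc n) (λ q-prime → factors± q-prime ∘ ∣ᵤ⇒∣)
    prime-factors-≡±1⇒≡±1 -[1+ n ]  _   factors± =
      ≡±1-neg (+-prime-factors-≡±1⇒≡±1 (suc n) (λ q-prime → factors± q-prime ∘ ∣ᵤ⇒∣))

  ≡±1[mod12]∧≡1[mod8]⇒≡1[mod24] : ∀ {a} → a ≡±1-mod + 12 → a ≡ 1ℤ [mod + 8 ] → a ≡ 1ℤ [mod + 24 ]
  ≡±1[mod12]∧≡1[mod8]⇒≡1[mod24] {a} a≡±1 a≡1 =
    ≡-mod-trans a≡r (check r<24 (Sum.map (≡-mod-trans r≡a) (≡-mod-trans r≡a) a≡±1)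
                                (≡-mod-trans (≡-mod-∣ (divides (+ 3) refl) (≡-mod-sym a≡r)) a≡1))
    where
    r : ℕ
    r = proj₁ (residue 24 a)
    r<24 : r ℕ.< 24
    r<24 = proj₁ (proj₂ (residue 24 a))
    a≡r : a ≡ + r [mod + 24 ]
    a≡r = proj₂ (proj₂ (residue 24 a))
    r≡a : + r ≡ a [mod + 12 ]
    r≡a = ≡-mod-∣ (divides (+ 2) refl) (≡-mod-sym a≡r)
    check : ∀ {r} → r ℕ.< 24 → + r ≡±1-mod + 12 → + r ≡ 1ℤ [mod + 8 ] → + r ≡ 1ℤ [mod + 24 ]
    check = from-yes (ℕ.allUpTo? (λ r → (+ r ≡? 1ℤ [mod + 12 ] ⊎-dec + r ≡? -1ℤ [mod + 12 ])
                                        →-dec + r ≡? 1ℤ [mod + 8 ] →-dec + r ≡? 1ℤ [mod + 24 ]) 24)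

  -- The quadratic character of 3

  -- ℤ[ω] with ω ^ 2 = - ω - 1, and ℤ[ζ₁₂] = ℤ[ω][ι] with ι ^ 2 = -1.  An element ((a , b) , (c , d))
  -- is a + b ω + (c + d ω) ι.  Then ζ = - ω ι is a primitive 12th root of unity, ζ⁻¹ = ω ^ 2 ι, and
  -- τ = ζ + ζ⁻¹ = - (1 + 2 ω) ι has τ ^ 2 = 3.
  module ℤ[ω] = QuadraticExtension ℤ.+-*-commutativeRing -1ℤ -1ℤ
  module ℤ[ζ₁₂] = QuadraticExtension ℤ[ω].commutativeRing (0ℤ , 0ℤ) (-1ℤ , 0ℤ)

  open ℤ[ζ₁₂] using (_+ᵉ_; _*ᵉ_; _^ᵉ_; _×ᵉ_; _≈ᵉ_; embed; *ᵉ-congˡ; ≈ᵉ-trans; ≈ᵉ-reflexive)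
  open CommutativeRing ℤ[ζ₁₂].commutativeRing using (Carrier)
  open import Algebra.Properties.Semiring.Exp ℤ[ζ₁₂].semiringᵉ using (^-assocʳ)

  ζ ζ⁻¹ τ : Carrier
  ζ   = (0ℤ , 0ℤ) , (0ℤ , -1ℤ)
  ζ⁻¹ = (0ℤ , 0ℤ) , (-1ℤ , -1ℤ)
  τ   = ζ +ᵉ ζ⁻¹

  ι-coefficient : Carrier → ℤ
  ι-coefficient x = proj₁ (proj₂ x)

  ι-coefficient-cong : ∀ {x y} → x ≈ᵉ y → ι-coefficient x ≡ ι-coefficient y
  ι-coefficient-cong x≈y = proj₁ (proj₂ x≈y)

  ι-coefficient-τ*embed : ∀ c → ι-coefficient (τ *ᵉ embed (ℤ[ω].embed c)) ≡ - c
  ι-coefficient-τ*embed c = begin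
    ι-coefficient (τ *ᵉ embed (ℤ[ω].embed c))  ≡⟨ proj₁ (proj₂ (ℤ[ζ₁₂].*ᵉ-embedʳ τ (ℤ[ω].embed c))) ⟩
    proj₁ (proj₂ τ ℤ[ω].*ᵉ ℤ[ω].embed c)       ≡⟨ proj₁ (ℤ[ω].*ᵉ-embedʳ (proj₂ τ) c) ⟩
    -1ℤ * c                                    ≡⟨ ℤ.-1*i≡-i c ⟩
    - c                                        ∎
    where open ≡-Reasoning

  ι-coefficient-× : ∀ n x → ι-coefficient (n ×ᵉ x) ≡ ι-coefficient x * + n
  ι-coefficient-× n x = begin
    ι-coefficient (n ×ᵉ x)       ≡⟨ proj₁ (proj₂ (ℤ[ζ₁₂].×ᵉ-pointwise n x)) ⟩
    proj₁ (n ℤ[ω].×ᵉ proj₂ x)   ≡⟨ proj₁ (ℤ[ω].×ᵉ-pointwise n (proj₂ x)) ⟩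
    n ×ᴿ ι-coefficient x         ≡⟨ ×ᴿ≡* n (ι-coefficient x) ⟩
    ι-coefficient x * + n        ∎
    where open ≡-Reasoning

  τ^[1+2h]≈τ*3ʰ : ∀ h → τ ^ᵉ suc (2 ℕ.* h) ≈ᵉ τ *ᵉ embed (ℤ[ω].embed ((+ 3) ^ h))
  τ^[1+2h]≈τ*3ʰ h = begin
    τ *ᵉ τ ^ᵉ (2 ℕ.* h)                        ≈⟨ *ᵉ-congˡ {τ} (^-assocʳ τ 2 h) ⟨
    τ *ᵉ embed (ℤ[ω].embed (+ 3)) ^ᵉ h          ≈⟨ *ᵉ-congˡ {τ} (ℤ[ζ₁₂].embed-^ (ℤ[ω].embed (+ 3)) h) ⟩
    τ *ᵉ embed (ℤ[ω].embed (+ 3) ℤ[ω].^ᵉ h)    ≈⟨ *ᵉ-congˡ {τ} (ℤ[ζ₁₂].embed-cong (ℤ[ω].embed-^ (+ 3) h)) ⟩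
    τ *ᵉ embed (ℤ[ω].embed ((+ 3) ^ᴿ h))        ≡⟨ cong (λ c → τ *ᵉ embed (ℤ[ω].embed c)) (^ᴿ≡^ (+ 3) h) ⟩
    τ *ᵉ embed (ℤ[ω].embed ((+ 3) ^ h))         ∎
    where open import Relation.Binary.Reasoning.Setoid ℤ[ζ₁₂].ᵉ-setoid

  -- Frobenius for τ = ζ + ζ⁻¹, with τ ^ (1 + 2 h) = 3 ^ h τ, read off in the ι-coordinate.
  -3ʰ≡ι[ζ^q+ζ⁻¹^q] : ∀ {q h} → Prime q → q ≡ suc (2 ℕ.* h) →
                     - ((+ 3) ^ h) ≡ ι-coefficient (ζ ^ᵉ q +ᵉ ζ⁻¹ ^ᵉ q) [mod + q ]
  -3ʰ≡ι[ζ^q+ζ⁻¹^q] {q} {h} q-prime refl = ≡-mod-trans (≡⇒≡-mod (begin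
    - ((+ 3) ^ h)                                        ≡⟨ ι-coefficient-τ*embed ((+ 3) ^ h) ⟨
    ι-coefficient (τ *ᵉ embed (ℤ[ω].embed ((+ 3) ^ h)))  ≡⟨ ι-coefficient-cong (τ^[1+2h]≈τ*3ʰ h) ⟨
    ι-coefficient (τ ^ᵉ q)                               ≡⟨ ι-coefficient-cong (proj₂ frobenius) ⟩
    trace + ι-coefficient (q ×ᵉ z)                       ≡⟨ cong (_+_ trace) (ι-coefficient-× q z) ⟩
    trace + ι-coefficient z * + q                        ∎))
    (+-multiple-≡-mod trace (ι-coefficient z))
    where
    open ≡-Reasoning
    frobenius : ∃[ z ] τ ^ᵉ q ≈ᵉ ζ ^ᵉ q +ᵉ ζ⁻¹ ^ᵉ q +ᵉ q ×ᵉ z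
    frobenius = Frobenius.frobenius (CommutativeRing.commutativeSemiring ℤ[ζ₁₂].commutativeRing) q-prime ζ ζ⁻¹
    z : Carrier
    z = proj₁ frobenius
    trace : ℤ
    trace = ι-coefficient (ζ ^ᵉ q +ᵉ ζ⁻¹ ^ᵉ q)

  residue-mod-12-cases : ∀ {r} → r ℕ.< 12 → 2 ℕ∣.∣ r ⊎ 3 ℕ∣.∣ r ⊎ r ≡ 1 ⊎ r ≡ 5 ⊎ r ≡ 7 ⊎ r ≡ 11
  residue-mod-12-cases = from-yes (ℕ.allUpTo? (λ r →
    2 ℕ∣.∣? r ⊎-dec 3 ℕ∣.∣? r ⊎-dec r ℕ.≟ 1 ⊎-dec r ℕ.≟ 5 ⊎-dec r ℕ.≟ 7 ⊎-dec r ℕ.≟ 11) 12)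

  x²≡3⇒q≡±1[mod12] : ∀ {q x} → Prime q → q ≢ 2 → q ≢ 3 → x ^ 2 ≡ + 3 [mod + q ] → + q ≡±1-mod + 12
  x²≡3⇒q≡±1[mod12] {q} {x} q-prime q≢2 q≢3 x²≡3 = classify (residue-mod-12-cases (ℕ.m%n<n q 12))
    where
    r : ℕ
    r = q ℕ.% 12

    q≡r : + q ≡ + r [mod + 12 ]
    q≡r = proj₂ (proj₂ (residue 12 (+ q)))

    ∣r⇒∣q : ∀ {d} → d ℕ∣.∣ 12 → d ℕ∣.∣ r → d ℕ∣.∣ q
    ∣r⇒∣q d∣12 d∣r = subst (_ ℕ∣.∣_) (sym (ℕ.m≡m%n+[m/n]*n q 12))
                                    (ℕ∣.∣m∣n⇒∣m+n d∣r (ℕ∣.∣n⇒∣m*n (q ℕ./ 12) d∣12))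

    periodic : ∀ {y} → y ^ᵉ 12 ≈ᵉ ℤ[ζ₁₂].1ᵉ → y ^ᵉ q ≈ᵉ y ^ᵉ r
    periodic {y} y¹²≈1 = ≈ᵉ-trans (≈ᵉ-reflexive (cong (y ^ᵉ_) (ℕ.m≡m%n+[m/n]*n q 12)))
                                  (^-periodic ℤ[ζ₁₂].semiringᵉ y¹²≈1 r (q ℕ./ 12))

    -1≡trace : -1ℤ ≡ ι-coefficient (ζ ^ᵉ r +ᵉ ζ⁻¹ ^ᵉ r) [mod + q ]
    -1≡trace = begin
      -1ℤ                                  ≈⟨ -‿cong-mod 3ʰ≡1 ⟨
      - ((+ 3) ^ h)                        ≈⟨ -3ʰ≡ι[ζ^q+ζ⁻¹^q] {h = h} q-prime q≡1+2h ⟩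
      ι-coefficient (ζ ^ᵉ q +ᵉ ζ⁻¹ ^ᵉ q)   ≡⟨ ι-coefficient-cong (ℤ[ζ₁₂].+ᵉ-cong (periodic ℤ[ζ₁₂].≈ᵉ-refl)
                                                                                  (periodic ℤ[ζ₁₂].≈ᵉ-refl)) ⟩
      ι-coefficient (ζ ^ᵉ r +ᵉ ζ⁻¹ ^ᵉ r)   ∎
      where
      open ≡-mod-Reasoning (+ q)
      h : ℕ
      h = proj₁ (odd-prime q-prime q≢2)
      q≡1+2h : q ≡ suc (2 ℕ.* h)
      q≡1+2h = proj₂ (odd-prime q-prime q≢2)
      q∤3 : ¬ (+ q ∣ + 3)
      q∤3 = q≢3 ∘ prime∣prime⇒≡ q-prime prime[3] ∘ ∣⇒∣ᵤ
      3ʰ≡1 : (+ 3) ^ h ≡ 1ℤ [mod + q ]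
      3ʰ≡1 = x²≡a⇒aʰ≡1 {h = h} {x} q-prime q≡1+2h q∤3 x²≡3

    trace≢1 : ι-coefficient (ζ ^ᵉ r +ᵉ ζ⁻¹ ^ᵉ r) ≢ 1ℤ
    trace≢1 trace≡1 = q≢2 (prime∣prime⇒≡ q-prime prime[2] (∣⇒∣ᵤ (∣m⇒∣-m (m∣a-b -1≡1))))
      where
      -1≡1 : -1ℤ ≡ 1ℤ [mod + q ]
      -1≡1 = ≡-mod-trans -1≡trace (≡⇒≡-mod trace≡1)

    classify : 2 ℕ∣.∣ r ⊎ 3 ℕ∣.∣ r ⊎ r ≡ 1 ⊎ r ≡ 5 ⊎ r ≡ 7 ⊎ r ≡ 11 → + q ≡±1-mod + 12
    classify (inj₁ 2∣r) =
      contradiction (prime∣prime⇒≡ prime[2] q-prime (∣r⇒∣q (ℕ∣.divides 6 refl) 2∣r)) (q≢2 ∘ sym)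
    classify (inj₂ (inj₁ 3∣r)) =
      contradiction (prime∣prime⇒≡ prime[3] q-prime (∣r⇒∣q (ℕ∣.divides 4 refl) 3∣r)) (q≢3 ∘ sym)
    classify (inj₂ (inj₂ (inj₁ r≡1))) = inj₁ (subst (λ r → + q ≡ + r [mod + 12 ]) r≡1 q≡r)
    classify (inj₂ (inj₂ (inj₂ (inj₁ r≡5)))) =
      contradiction (cong (λ r → ι-coefficient (ζ ^ᵉ r +ᵉ ζ⁻¹ ^ᵉ r)) r≡5) trace≢1
    classify (inj₂ (inj₂ (inj₂ (inj₂ (inj₁ r≡7))))) =
      contradiction (cong (λ r → ι-coefficient (ζ ^ᵉ r +ᵉ ζ⁻¹ ^ᵉ r)) r≡7) trace≢1
    classify (inj₂ (inj₂ (inj₂ (inj₂ (inj₂ r≡11))))) =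
      inj₂ (≡-mod-trans (subst (λ r → + q ≡ + r [mod + 12 ]) r≡11 q≡r) (mk (divides 1ℤ refl)))

  -- Geometric sums

  [y-1]*cyclo≡yⁿ-1 : ∀ y n → (y - 1ℤ) * cyclo y n ≡ y ^ n - 1ℤ
  [y-1]*cyclo≡yⁿ-1 y zero    = lemma y
    where lemma : ∀ y → (y - 1ℤ) * 0ℤ ≡ 1ℤ - 1ℤ
          lemma = solve-∀
  [y-1]*cyclo≡yⁿ-1 y (suc n) = begin
    (y - 1ℤ) * (cyclo y n + y ^ n)            ≡⟨ ℤ.*-distribˡ-+ (y - 1ℤ) (cyclo y n) (y ^ n) ⟩
    (y - 1ℤ) * cyclo y n + (y - 1ℤ) * y ^ n   ≡⟨ cong (_+ (y - 1ℤ) * y ^ n) ([y-1]*cyclo≡yⁿ-1 y n) ⟩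
    (y ^ n - 1ℤ) + (y - 1ℤ) * y ^ n           ≡⟨ lemma y (y ^ n) ⟩
    y * y ^ n - 1ℤ                            ∎
    where
    open ≡-Reasoning
    lemma : ∀ y u → (u - 1ℤ) + (y - 1ℤ) * u ≡ y * u - 1ℤ
    lemma = solve-∀

  cyclo-cong-mod : ∀ {m a b} n → a ≡ b [mod m ] → cyclo a n ≡ cyclo b n [mod m ]
  cyclo-cong-mod zero    _   = ≡-mod-refl
  cyclo-cong-mod (suc n) a≡b = +-cong-mod (cyclo-cong-mod n a≡b) (^-cong-mod n a≡b)

  cyclo-1 : ∀ n → cyclo 1ℤ n ≡ + n
  cyclo-1 zero    = refl
  cyclo-1 (suc n) = trans (cong₂ _+_ (cyclo-1 n) (ℤ.^-zeroˡ n)) (cong +_ (ℕ.+-comm n 1))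

  ≡1-mod⇒cyclo≡n : ∀ {m a} n → a ≡ 1ℤ [mod m ] → cyclo a n ≡ + n [mod m ]
  ≡1-mod⇒cyclo≡n n a≡1 = ≡-mod-trans (cyclo-cong-mod n a≡1) (≡⇒≡-mod (cyclo-1 n))

  cyclo-[-1]-even : ∀ h → cyclo -1ℤ (2 ℕ.* h) ≡ 0ℤ
  cyclo-[-1]-even zero    = refl
  cyclo-[-1]-even (suc h) = begin
    cyclo -1ℤ (2 ℕ.* suc h)             ≡⟨ cong (cyclo -1ℤ) (ℕ.*-suc 2 h) ⟩
    cyclo -1ℤ (2 ℕ.* h) + u + -1ℤ * u   ≡⟨ cong (λ c → c + u + -1ℤ * u) (cyclo-[-1]-even h) ⟩
    0ℤ + u + -1ℤ * u                    ≡⟨ lemma u ⟩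
    0ℤ                                  ∎
    where
    open ≡-Reasoning
    u : ℤ
    u = -1ℤ ^ (2 ℕ.* h)
    lemma : ∀ u → 0ℤ + u + -1ℤ * u ≡ 0ℤ
    lemma = solve-∀

  cyclo-[-1]-odd : ∀ h → cyclo -1ℤ (suc (2 ℕ.* h)) ≡ 1ℤ
  cyclo-[-1]-odd h = begin
    cyclo -1ℤ (2 ℕ.* h) + -1ℤ ^ (2 ℕ.* h)   ≡⟨ cong₂ _+_ (cyclo-[-1]-even h) (sym (ℤ.^-*-assoc -1ℤ 2 h)) ⟩
    0ℤ + (-1ℤ ^ 2) ^ h                      ≡⟨ ℤ.+-identityˡ _ ⟩
    1ℤ ^ h                                  ≡⟨ ℤ.^-zeroˡ h ⟩
    1ℤ                                      ∎
    where open ≡-Reasoning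

  [1+a]ⁿ≡1+na : ∀ a n → (1ℤ + a) ^ n ≡ 1ℤ + + n * a [mod a * a ]
  [1+a]ⁿ≡1+na a zero    = ≡-mod-refl
  [1+a]ⁿ≡1+na a (suc n) = begin
    (1ℤ + a) * (1ℤ + a) ^ n                 ≈⟨ *-cong-mod (≡-mod-refl {a = 1ℤ + a}) ([1+a]ⁿ≡1+na a n) ⟩
    (1ℤ + a) * (1ℤ + + n * a)               ≡⟨ lemma a (+ n) ⟩
    (1ℤ + (1ℤ + + n) * a) + + n * (a * a)   ≈⟨ +-multiple-≡-mod _ (+ n) ⟩
    1ℤ + + suc n * a                        ∎
    where
    open ≡-mod-Reasoning (a * a)
    lemma : ∀ a t → (1ℤ + a) * (1ℤ + t * a) ≡ (1ℤ + (1ℤ + t) * a) + t * (a * a)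
    lemma = solve-∀

  cyclo-[1+a]-odd : ∀ a h → cyclo (1ℤ + a) (suc (2 ℕ.* h)) ≡ (1ℤ + + 2 * + h) * (1ℤ + a * + h) [mod a * a ]
  cyclo-[1+a]-odd a zero    = ≡⇒≡-mod (lemma a)
    where lemma : ∀ a → 0ℤ + 1ℤ ≡ (1ℤ + + 2 * 0ℤ) * (1ℤ + a * 0ℤ)
          lemma = solve-∀
  cyclo-[1+a]-odd a (suc h) = begin
    cyclo (1ℤ + a) (suc (2 ℕ.* suc h))
      ≡⟨ cong (cyclo (1ℤ + a) ∘ suc) (ℕ.*-suc 2 h) ⟩
    cyclo (1ℤ + a) (suc n) + (1ℤ + a) ^ suc n + (1ℤ + a) ^ suc (suc n)
      ≈⟨ +-cong-mod (+-cong-mod (cyclo-[1+a]-odd a h) ([1+a]ⁿ≡1+na a (suc n))) ([1+a]ⁿ≡1+na a (suc (suc n))) ⟩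
    (1ℤ + + 2 * t) * (1ℤ + a * t) + (1ℤ + (1ℤ + + n) * a) + (1ℤ + (1ℤ + (1ℤ + + n)) * a)
      ≡⟨ cong (λ u → (1ℤ + + 2 * t) * (1ℤ + a * t) + (1ℤ + (1ℤ + u) * a) + (1ℤ + (1ℤ + (1ℤ + u)) * a))
              (ℤ.pos-* 2 h) ⟩
    (1ℤ + + 2 * t) * (1ℤ + a * t) + (1ℤ + (1ℤ + + 2 * t) * a) + (1ℤ + (1ℤ + (1ℤ + + 2 * t)) * a)
      ≡⟨ lemma a t ⟩
    (1ℤ + + 2 * (1ℤ + t)) * (1ℤ + a * (1ℤ + t))
      ∎
    where
    open ≡-mod-Reasoning (a * a)
    n : ℕ
    n = 2 ℕ.* h
    t : ℤ
    t = + h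
    lemma : ∀ a t → (1ℤ + + 2 * t) * (1ℤ + a * t) + (1ℤ + (1ℤ + + 2 * t) * a)
                      + (1ℤ + (1ℤ + (1ℤ + + 2 * t)) * a)
                  ≡ (1ℤ + + 2 * (1ℤ + t)) * (1ℤ + a * (1ℤ + t))
    lemma = solve-∀

  *-^-absorb : ∀ {m u v} → u * v ≡ u [mod m ] → ∀ k → u * v ^ k ≡ u [mod m ]
  *-^-absorb {m} {u} {v} uv≡u zero    = ≡⇒≡-mod (ℤ.*-identityʳ u)
  *-^-absorb {m} {u} {v} uv≡u (suc k) = begin
    u * (v * v ^ k)   ≡⟨ ℤ.*-assoc u v (v ^ k) ⟨
    u * v * v ^ k     ≈⟨ *-cong-mod uv≡u (≡-mod-refl {a = v ^ k}) ⟩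
    u * v ^ k         ≈⟨ *-^-absorb uv≡u k ⟩
    u                 ∎
    where open ≡-mod-Reasoning m

  y³*y²≡y³[mod24] : ∀ y → y ^ 3 * y ^ 2 ≡ y ^ 3 [mod + 24 ]
  y³*y²≡y³[mod24] y = begin
    y ^ 3 * y ^ 2          ≈⟨ *-cong-mod (^-cong-mod 3 y≡r) (^-cong-mod 2 y≡r) ⟩
    (+ r) ^ 3 * (+ r) ^ 2  ≈⟨ check (proj₁ (proj₂ (residue 24 y))) ⟩
    (+ r) ^ 3              ≈⟨ ^-cong-mod 3 y≡r ⟨
    y ^ 3                  ∎
    where
    open ≡-mod-Reasoning (+ 24)
    r : ℕ
    r = proj₁ (residue 24 y)
    y≡r : y ≡ + r [mod + 24 ]
    y≡r = proj₂ (proj₂ (residue 24 y))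
    check : ∀ {r} → r ℕ.< 24 → (+ r) ^ 3 * (+ r) ^ 2 ≡ (+ r) ^ 3 [mod + 24 ]
    check = from-yes (ℕ.allUpTo? (λ r → (+ r) ^ 3 * (+ r) ^ 2 ≡? (+ r) ^ 3 [mod + 24 ]) 24)

  y^[3+2k]≡y³[mod24] : ∀ y k → y ^ suc (2 ℕ.* suc k) ≡ y ^ 3 [mod + 24 ]
  y^[3+2k]≡y³[mod24] y k = begin
    y ^ suc (2 ℕ.* suc k)   ≡⟨ cong (λ n → y ^ suc n) (ℕ.*-suc 2 k) ⟩
    y ^ (3 ℕ.+ 2 ℕ.* k)     ≡⟨ ℤ.^-distribˡ-+-* y 3 (2 ℕ.* k) ⟩
    y ^ 3 * y ^ (2 ℕ.* k)   ≡⟨ cong (y ^ 3 *_) (ℤ.^-*-assoc y 2 k) ⟨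
    y ^ 3 * (y ^ 2) ^ k     ≈⟨ *-^-absorb (y³*y²≡y³[mod24] y) k ⟩
    y ^ 3                   ∎
    where open ≡-mod-Reasoning (+ 24)

  module Equation {x y : ℤ} {p : ℕ} (p-prime : Prime p) (p≥3 : p ℕ.≥ 3) (x²-2≡yᵖ : x ^ 2 - + 2 ≡ y ^ p)
    where

    Φ : ℤ
    Φ = cyclo y p

    p≢2 : p ≢ 2
    p≢2 refl = contradiction p≥3 λ { (s≤s (s≤s ())) }

    h : ℕ
    h = proj₁ (odd-prime p-prime p≢2)

    p≡1+2h : p ≡ suc (2 ℕ.* h)
    p≡1+2h = proj₂ (odd-prime p-prime p≢2)

    p≡3+2k : ∃[ k ] p ≡ suc (2 ℕ.* suc k)
    p≡3+2k with h | p≡1+2h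
    ... | zero  | refl = contradiction p≥3 λ { (s≤s ()) }
    ... | suc k | p≡3+2k = k , p≡3+2k

    [y-1]Φ≡x²-3 : (y - 1ℤ) * Φ ≡ x ^ 2 - + 3
    [y-1]Φ≡x²-3 = trans ([y-1]*cyclo≡yⁿ-1 y p) (trans (cong (_- 1ℤ) (sym x²-2≡yᵖ)) (lemma (x ^ 2)))
      where lemma : ∀ t → t - + 2 - 1ℤ ≡ t - + 3
            lemma = solve-∀

    ∣Φ⇒∣x²-3 : ∀ {d} → d ∣ Φ → d ∣ x ^ 2 - + 3
    ∣Φ⇒∣x²-3 d∣Φ = subst (_ ∣_) [y-1]Φ≡x²-3 (∣n⇒∣m*n (y - 1ℤ) d∣Φ)

    x²-2≡y³[mod24] : x ^ 2 - + 2 ≡ y ^ 3 [mod + 24 ]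
    x²-2≡y³[mod24] = ≡-mod-trans (≡⇒≡-mod x²-2≡yᵖ)
      (subst (λ n → y ^ n ≡ y ^ 3 [mod + 24 ]) (sym (proj₂ p≡3+2k)) (y^[3+2k]≡y³[mod24] y (proj₁ p≡3+2k)))

    y≡-1[mod8] : y ≡ -1ℤ [mod + 8 ]
    y≡-1[mod8] = ≡-mod-trans y≡s (check (proj₁ (proj₂ (residue 8 x))) (proj₁ (proj₂ (residue 8 y))) (begin
      (+ r) ^ 2 - + 2   ≈⟨ +-cong-mod (^-cong-mod 2 x≡r) ≡-mod-refl ⟨
      x ^ 2 - + 2       ≈⟨ ≡-mod-∣ (divides (+ 3) refl) x²-2≡y³[mod24] ⟩
      y ^ 3             ≈⟨ ^-cong-mod 3 y≡s ⟩
      (+ s) ^ 3         ∎))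
      where
      open ≡-mod-Reasoning (+ 8)
      r s : ℕ
      r = proj₁ (residue 8 x)
      s = proj₁ (residue 8 y)
      x≡r : x ≡ + r [mod + 8 ]
      x≡r = proj₂ (proj₂ (residue 8 x))
      y≡s : y ≡ + s [mod + 8 ]
      y≡s = proj₂ (proj₂ (residue 8 y))
      check : ∀ {r} → r ℕ.< 8 → ∀ {s} → s ℕ.< 8 →
              (+ r) ^ 2 - + 2 ≡ (+ s) ^ 3 [mod + 8 ] → + s ≡ -1ℤ [mod + 8 ]
      check = from-yes (ℕ.allUpTo? (λ r → ℕ.allUpTo? (λ s →
        (+ r) ^ 2 - + 2 ≡? (+ s) ^ 3 [mod + 8 ] →-dec + s ≡? -1ℤ [mod + 8 ]) 8) 8)

    Φ≡1[mod8] : Φ ≡ 1ℤ [mod + 8 ]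
    Φ≡1[mod8] = ≡-mod-trans (cyclo-cong-mod p y≡-1[mod8])
      (≡⇒≡-mod (trans (cong (cyclo -1ℤ) p≡1+2h) (cyclo-[-1]-odd h)))

    3∣x⇒y≡1[mod3] : + 3 ∣ x → y ≡ 1ℤ [mod + 3 ]
    3∣x⇒y≡1[mod3] 3∣x = begin
      y              ≈⟨ fermat prime[3] y ⟨
      y ^ 3          ≈⟨ ≡-mod-∣ (divides (+ 8) refl) x²-2≡y³[mod24] ⟨
      x ^ 2 - + 2    ≈⟨ +-cong-mod (^-cong-mod 2 (∣⇒≡0-mod 3∣x)) ≡-mod-refl ⟩
      0ℤ ^ 2 - + 2   ≈⟨ mk (divides -1ℤ refl) ⟩
      1ℤ             ∎
      where open ≡-mod-Reasoning (+ 3)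

    prime∣Φ⇒≢2 : ∀ {q} → Prime q → + q ∣ Φ → q ≢ 2
    prime∣Φ⇒≢2 _ 2∣Φ refl = prime∤1 prime[2] (∣-resp-≡-mod (≡-mod-∣ (divides (+ 4) refl) Φ≡1[mod8]) 2∣Φ)

    -- 3 ∣ Φ would give 3 ∣ x, hence y ≡ 1 (mod 3), and then 9 divides both x ^ 2 and (y - 1) Φ = x ^ 2 - 3.
    3∤Φ : ¬ (+ 3 ∣ Φ)
    3∤Φ 3∣Φ = from-no (+ 9 ∣? + 3) (subst (+ 9 ∣_) (lemma (x ^ 2)) (∣m∣n⇒∣m-n 9∣x² 9∣x²-3))
      where
      lemma : ∀ t → t - (t - + 3) ≡ + 3
      lemma = solve-∀
      3∣x² : + 3 ∣ x ^ 2
      3∣x² = subst (+ 3 ∣_) (lemma′ (x ^ 2)) (∣m∣n⇒∣m+n (∣Φ⇒∣x²-3 3∣Φ) ∣-refl)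
        where lemma′ : ∀ t → t - + 3 + + 3 ≡ t
              lemma′ = solve-∀
      3∣x : + 3 ∣ x
      3∣x = [ id , subst (+ 3 ∣_) (ℤ.^-identityʳ x) ]′ (euclidsLemmaℤ prime[3] x (x ^ 1) 3∣x²)
      9∣x² : + 9 ∣ x ^ 2
      9∣x² = *-pres-∣ 3∣x (subst (+ 3 ∣_) (sym (ℤ.^-identityʳ x)) 3∣x)
      9∣x²-3 : + 9 ∣ x ^ 2 - + 3
      9∣x²-3 = subst (+ 9 ∣_) [y-1]Φ≡x²-3 (*-pres-∣ (m∣a-b (3∣x⇒y≡1[mod3] 3∣x)) 3∣Φ)

    prime∣Φ⇒≡±1[mod12] : ∀ {q} → Prime q → + q ∣ Φ → + q ≡±1-mod + 12
    prime∣Φ⇒≡±1[mod12] {q} q-prime q∣Φ = x²≡3⇒q≡±1[mod12] {x = x} q-prime (prime∣Φ⇒≢2 q-prime q∣Φ) q≢3 x²≡3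
      where
      q≢3 : q ≢ 3
      q≢3 refl = 3∤Φ q∣Φ
      x²≡3 : x ^ 2 ≡ + 3 [mod + q ]
      x²≡3 = mk (∣Φ⇒∣x²-3 q∣Φ)

    prime∣Φ⇒≡p⊎≡1[modp] : ∀ {q} → Prime q → + q ∣ Φ → (q ≡ p) ⊎ (+ q ≡ 1ℤ [mod + p ])
    prime∣Φ⇒≡p⊎≡1[modp] {q} q-prime q∣Φ with + q ∣? y - 1ℤ | p ℕ∣.∣? q ∸ 1
    ... | yes q∣y-1 | _ =
      inj₁ (prime∣prime⇒≡ q-prime p-prime (∣⇒∣ᵤ (∣-resp-≡-mod (≡1-mod⇒cyclo≡n p (mk q∣y-1)) q∣Φ)))
    ... | no _ | yes p∣q-1 = inj₂ (mk (subst (+ p ∣_) (q-1≡q-1 q-prime) (∣ᵤ⇒∣ p∣q-1)))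
      where
      q-1≡q-1 : ∀ {q} → Prime q → + (q ∸ 1) ≡ + q - 1ℤ
      q-1≡q-1 {suc q} _ = refl
    ... | no q∤y-1 | no p∤q-1 = contradiction (m∣a-b y≡1) q∤y-1
      where
      yᵖ≡1 : y ^ p ≡ 1ℤ [mod + q ]
      yᵖ≡1 = mk (subst (+ q ∣_) ([y-1]*cyclo≡yⁿ-1 y p) (∣n⇒∣m*n (y - 1ℤ) q∣Φ))
      q∤y : ¬ (+ q ∣ y)
      q∤y q∣y = prime∤1 q-prime (∣-resp-≡-mod yᵖ≡1 (subst (λ n → + q ∣ y ^ n) (sym p≡1+2h) (∣m⇒∣m*n _ q∣y)))
      y≡1 : y ≡ 1ℤ [mod + q ]
      y≡1 = coprime-exponents⇒≡1 (prime∤⇒coprime p-prime p∤q-1) yᵖ≡1 (fermat′ q-prime q∤y)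

    p∤y-1⇒Φ≡1[modp] : ¬ (+ p ∣ y - 1ℤ) → Φ ≡ 1ℤ [mod + p ]
    p∤y-1⇒Φ≡1[modp] p∤y-1 =
      mk ([ flip contradiction p∤y-1 , id ]′ (euclidsLemmaℤ p-prime (y - 1ℤ) (Φ - 1ℤ) p∣[y-1][Φ-1]))
      where
      p∣[y-1][Φ-1] : + p ∣ (y - 1ℤ) * (Φ - 1ℤ)
      p∣[y-1][Φ-1] = subst (+ p ∣_) (begin
        y ^ p - y                 ≡⟨ lemma₁ (y ^ p) y ⟨
        (y ^ p - 1ℤ) - (y - 1ℤ)   ≡⟨ cong (_- (y - 1ℤ)) ([y-1]*cyclo≡yⁿ-1 y p) ⟨
        (y - 1ℤ) * Φ - (y - 1ℤ)   ≡⟨ lemma₂ (y - 1ℤ) Φ ⟩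
        (y - 1ℤ) * (Φ - 1ℤ)       ∎) (m∣a-b (fermat p-prime y))
        where
        open ≡-Reasoning
        lemma₁ : ∀ u y → (u - 1ℤ) - (y - 1ℤ) ≡ u - y
        lemma₁ = solve-∀
        lemma₂ : ∀ a c → a * c - a ≡ a * (c - 1ℤ)
        lemma₂ = solve-∀

    p∣y-1⇒Φ≡p[modp²] : + p ∣ y - 1ℤ → Φ ≡ + p [mod (+ p) ^ 2 ]
    p∣y-1⇒Φ≡p[modp²] (divides s a≡sp) = begin
      cyclo y p                           ≡⟨ cong₂ cyclo (lemma₁ y) p≡1+2h ⟩
      cyclo (1ℤ + a) (suc (2 ℕ.* h))      ≈⟨ ≡-mod-∣ p²∣a² (cyclo-[1+a]-odd a h) ⟩
      (1ℤ + + 2 * + h) * (1ℤ + a * + h)   ≡⟨ cong₂ (λ P a → P * (1ℤ + a * + h)) (sym p≡1+2hℤ) a≡sp ⟩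
      + p * (1ℤ + s * + p * + h)          ≡⟨ lemma₂ (+ p) s (+ h) ⟩
      + p + s * + h * (+ p) ^ 2           ≈⟨ +-multiple-≡-mod (+ p) (s * + h) ⟩
      + p                                 ∎
      where
      open ≡-mod-Reasoning ((+ p) ^ 2)
      a : ℤ
      a = y - 1ℤ
      p≡1+2hℤ : + p ≡ 1ℤ + + 2 * + h
      p≡1+2hℤ = trans (cong +_ p≡1+2h) (cong (_+_ 1ℤ) (ℤ.pos-* 2 h))
      lemma₁ : ∀ y → y ≡ 1ℤ + (y - 1ℤ)
      lemma₁ = solve-∀
      lemma₂ : ∀ P s t → P * (1ℤ + s * P * t) ≡ P + s * t * (P * (P * 1ℤ))
      lemma₂ = solve-∀
      lemma₃ : ∀ s P → s * P * (s * P) ≡ s * s * (P * (P * 1ℤ))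
      lemma₃ = solve-∀
      p²∣a² : (+ p) ^ 2 ∣ a * a
      p²∣a² = divides (s * s) (trans (cong₂ _*_ a≡sp a≡sp) (lemma₃ s (+ p)))

    Φ-mod-p : (¬ (+ p ∣ y - 1ℤ) × Φ ≡ 1ℤ [mod + p ]) ⊎ (+ p ∣ y - 1ℤ × Φ ≡ + p [mod (+ p) ^ 2 ])
    Φ-mod-p with + p ∣? y - 1ℤ
    ... | yes p∣y-1 = inj₂ (p∣y-1 , p∣y-1⇒Φ≡p[modp²] p∣y-1)
    ... | no  p∤y-1 = inj₁ (p∤y-1 , p∤y-1⇒Φ≡1[modp] p∤y-1)

    p∣y-1⇒p≡±1[mod12] : + p ∣ y - 1ℤ → + p ≡±1-mod + 12
    p∣y-1⇒p≡±1[mod12] p∣y-1 = prime∣Φ⇒≡±1[mod12] p-prime (∣-resp-≡-mod (≡-mod-sym Φ≡p[modp]) ∣-refl)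
      where
      Φ≡p[modp] : Φ ≡ + p [mod + p ]
      Φ≡p[modp] = ≡-mod-∣ (∣m⇒∣m*n ((+ p) ^ 1) ∣-refl) (p∣y-1⇒Φ≡p[modp²] p∣y-1)

    Φ≡1[mod24] : Φ ≡ 1ℤ [mod + 24 ]
    Φ≡1[mod24] = ≡±1[mod12]∧≡1[mod8]⇒≡1[mod24] (prime-factors-≡±1⇒≡±1 Φ Φ≢0 prime∣Φ⇒≡±1[mod12]) Φ≡1[mod8]
      where
      Φ≢0 : Φ ≢ 0ℤ
      Φ≢0 Φ≡0 = from-no (+ 8 ∣? 1ℤ) (∣-resp-≡-mod (subst (_≡ 1ℤ [mod + 8 ]) Φ≡0 Φ≡1[mod8]) (divides 0ℤ refl))

    3∣x⇒p≡1[mod3] : + 3 ∣ x → + p ≡ 1ℤ [mod + 3 ]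
    3∣x⇒p≡1[mod3] 3∣x = begin
      + p   ≈⟨ ≡1-mod⇒cyclo≡n p (3∣x⇒y≡1[mod3] 3∣x) ⟨
      Φ     ≈⟨ ≡-mod-∣ (divides (+ 8) refl) Φ≡1[mod24] ⟩
      1ℤ    ∎
      where open ≡-mod-Reasoning (+ 3)

open import Data.Nat using (_≥_)
open import Data.Integer using (ℤ; +_; -[1+_]; _-_; _^_)
open import Data.Integer.Divisibility using (_∣_)
import Data.Integer.Divisibility.Signed as Signed
import Data.Product as Product

≡-mod⇒≡ₘ : ∀ {a b m} → a ≡ b [mod m ] → a ≡ₘ b [mod m ]
≡-mod⇒≡ₘ = Signed.∣⇒∣ᵤ ∘ m∣a-b

≡ₘ⇒≡-mod : ∀ {a b m} → a ≡ₘ b [mod m ] → a ≡ b [mod m ]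
≡ₘ⇒≡-mod = mk ∘ Signed.∣ᵤ⇒∣

≡±1-mod⇒≡±1[mod] : ∀ {a m} → a ≡±1-mod m → ≡±1[mod m ] a
≡±1-mod⇒≡±1[mod] = Sum.map ≡-mod⇒≡ₘ ≡-mod⇒≡ₘ

theorem2p8 : (x y : ℤ) (p : ℕ) → Prime p → p ≥ 3 → (x ^ 2) - (+ 2) ≡ y ^ p → y ≢ -[1+ 0 ] →
    ((q : ℕ) → Prime q → + q ∣ cyclo y p → ≡±1[mod + 12 ] (+ q))
    × ((q : ℕ) → Prime q → + q ∣ cyclo y p → (q ≡ p) ⊎ (+ q ≡ₘ + 1 [mod + p ]))
    × ((¬ (+ p ∣ (y - + 1)) × (cyclo y p ≡ₘ + 1 [mod + p ]))
       ⊎ ((+ p ∣ (y - + 1)) × (cyclo y p ≡ₘ + p [mod (+ p) ^ 2 ])))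
    × ((+ p ∣ (y - + 1)) → ≡±1[mod + 12 ] (+ p))
    × (cyclo y p ≡ₘ + 1 [mod + 24 ])
    × ((+ p ≡ₘ + 2 [mod + 3 ]) ⊎ p ≡ 3 → ¬ (+ 3 ∣ x))
theorem2p8 x y p p-prime p≥3 x²-2≡yᵖ _ =
    (λ q q-prime → ≡±1-mod⇒≡±1[mod] ∘ prime∣Φ⇒≡±1[mod12] q-prime ∘ Signed.∣ᵤ⇒∣)
  , (λ q q-prime → Sum.map₂ ≡-mod⇒≡ₘ ∘ prime∣Φ⇒≡p⊎≡1[modp] q-prime ∘ Signed.∣ᵤ⇒∣)
  , Sum.map (Product.map (_∘ Signed.∣ᵤ⇒∣) ≡-mod⇒≡ₘ) (Product.map Signed.∣⇒∣ᵤ ≡-mod⇒≡ₘ) Φ-mod-p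
  , ≡±1-mod⇒≡±1[mod] ∘ p∣y-1⇒p≡±1[mod12] ∘ Signed.∣ᵤ⇒∣
  , ≡-mod⇒≡ₘ Φ≡1[mod24]
  , λ p≡2∨p≡3 → p≢1[mod3] p≡2∨p≡3 ∘ 3∣x⇒p≡1[mod3] ∘ Signed.∣ᵤ⇒∣
  where
  open Equation {x} {y} p-prime p≥3 x²-2≡yᵖ

  p≢1[mod3] : (+ p ≡ₘ + 2 [mod + 3 ]) ⊎ p ≡ 3 → ¬ (+ p ≡ 1ℤ [mod + 3 ])
  p≢1[mod3] (inj₁ p≡2) p≡1 = from-no (+ 2 ≡? 1ℤ [mod + 3 ]) (≡-mod-trans (≡-mod-sym (≡ₘ⇒≡-mod p≡2)) p≡1)
  p≢1[mod3] (inj₂ refl) p≡1 = from-no (+ 3 ≡? 1ℤ [mod + 3 ]) p≡1
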